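{- Let $\ell\geq 6$ and $k\geq 3$ be integers, and let $G$ be a graph with distinct vertices $v,v_0,v_1,\dots,v_{\ell+1}$ such that $P=(v_1,\dots,v_\ell)$ is a path in $G$ and $N_G(v_i)=\{v_{i-1},v,v_{i+1}\}$ for each $i\in[\ell]$. Let $D_1$ and $D_2$ be proper $k$-orientations of $G-E(P)$ such that, for each $j\in\{1,2\}$: $(v,v_i)$ is an arc of $D_j$ for every $i\in[\ell]$, $d^-_{D_j}(v_\ell)=2$ and $d^-_{D_j}(v)\geq 4$; and moreover $d^-_{D_1}(v_1)=2$ and $d^-_{D_2}(v_1)=1$. Then each of $D_1$ and $D_2$ can be extended (by orienting the edges of $P$) to a proper $k$-orientation of $G$.
   Context: An orientation $D$ of a graph $G$ replaces each edge by exactly one of its two possible arcs; $d^-_D(v)$ is the indegree of $v$. $D$ is proper if adjacent vertices have distinct indegrees; a $k$-orientation has maximum indegree at most $k$. $G-E(P)$ is the graph obtained from $G$ by deleting the edges of $P$. -}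

module Defs where

open import Data.Nat using (ℕ; zero; suc; _+_; _≤_; _<_)
open import Data.Fin using (Fin)
open import Data.Bool using (Bool; true; false; if_then_else_)
open import Data.List using (List; map; allFin)
open import Data.Nat.ListAction using (sum)
open import Data.Product using (Σ; _×_; _,_)
open import Data.Sum using (_⊎_)
open import Relation.Nullary using (¬_)
open import Relation.Binary.PropositionalEquality using (_≡_; _≢_)

record Graph (n : ℕ) : Set₁ where
  field
    Adj    : Fin n → Fin n → Set
    sym    : ∀ {u v} → Adj u v → Adj v u
    irrefl : ∀ {u} → ¬ Adj u u
open Graph public

Arcs : ℕ → Set
Arcs n = Fin n → Fin n → Bool

IsOrientation : ∀ {n} → (Fin n → Fin n → Set) → Arcs n → Set
IsOrientation H D =
  (∀ u v → D u v ≡ true → H u v) ×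
  (∀ u v → H u v → D u v ≡ true ⊎ D v u ≡ true) ×
  (∀ u v → ¬ (D u v ≡ true × D v u ≡ true))

indeg : ∀ {n} → Arcs n → Fin n → ℕ
indeg {n} D v = sum (map (λ u → if D u v then 1 else 0) (allFin n))

IsProperKOrientation : ∀ {n} → ℕ → (Fin n → Fin n → Set) → Arcs n → Set
IsProperKOrientation k H D =
  IsOrientation H D ×
  (∀ u v → H u v → indeg D u ≢ indeg D v) ×
  (∀ u → indeg D u ≤ k)

PathEdge : ∀ {n} → ℕ → (ℕ → Fin n) → Fin n → Fin n → Set
PathEdge ℓ w x y = Σ ℕ λ i → (1 ≤ i × i < ℓ) ×
  ((x ≡ w i × y ≡ w (suc i)) ⊎ (x ≡ w (suc i) × y ≡ w i))

DeleteEdges : ∀ {n} → (Fin n → Fin n → Set) → (Fin n → Fin n → Set) → Fin n → Fin n → Set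
DeleteEdges H E x y = H x y × ¬ E x y

Extends : ∀ {n} → (Fin n → Fin n → Set) → Arcs n → Arcs n → Set
Extends H D D' = ∀ u v → H u v → D' u v ≡ D u v

ExtendsToProper : ∀ {n} → ℕ → Graph n → (Fin n → Fin n → Set) → Arcs n → Set
ExtendsToProper {n} k G H D =
  Σ (Arcs n) λ D' → IsProperKOrientation k (Adj G) D' × Extends H D D'

-- Orient the path edges w i w (1 + i) alternately, starting with w 1 → w 2, except that the last
-- two edges are oriented w (ℓ - 2) → w (ℓ - 1) ← w ℓ. Then w 1 and w ℓ receive no path arc and keep
-- their indegrees, which already differ from those of w 0 and w (1 + ℓ). An interior vertex w j has
-- indegree 1 (the arc from v) plus the number of path arcs into it; this lies in {1, 2, 3}, and two
-- consecutive interior vertices could only agree if three consecutive path edges were oriented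
-- alike, which never happens. Both w 2 and w (ℓ - 1) get indegree 3, which separates them from
-- w 1 (indegree at most 2) and w ℓ (indegree 2). Finally every path vertex has indegree at most
-- 3 < 4 ≤ d⁻(v) and 3 ≤ k.
module Submission where

open import Defs hiding (sym)
open import Data.Bool using (Bool; true; false; not; if_then_else_; _∨_)
open import Data.Bool.Properties using (∨-zeroʳ; ∨-identityʳ; ¬-not; not-¬) renaming (_≟_ to _≟ᵇ_)
open import Data.Empty using (⊥; ⊥-elim)
open import Data.Fin using (Fin; zero; suc; punchIn; punchOut)
open import Data.Fin.Properties using (_≟_; punchInᵢ≢i; punchIn-punchOut; punchOut-punchIn; punchOut-cong)
open import Data.List using (tabulate)
open import Data.List.Properties using (map-tabulate)
open import Data.Nat using (ℕ; zero; suc; _+_; _≤_; _<_; _∸_; z≤n; s≤s)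
open import Data.Nat.ListAction using (sum)
open import Data.Nat.Properties
  using (+-0-commutativeMonoid; +-identityʳ; +-mono-≤; _≤?_; _<?_; ≤-refl; ≤-trans; ≤-reflexive; ≤-antisym; ≤-pred;
         <⇒≤; <⇒≢; <-trans; <-irrefl; <-asym; ≮⇒≥; n<1+n; n≤1+n; m≤n⇒m≤1+n; 1+n≰n; m≢1+n+m; anyUpTo?; module ≤-Reasoning)
open import Data.Product using (∃; _×_; _,_; proj₁; proj₂)
open import Data.Sum using (_⊎_; inj₁; inj₂; [_,_]′; map)
open import Function using (_⇔_; Equivalence; _∘_; id; case_of_)
open import Relation.Nullary using (¬_; Dec; does; yes; no)
open import Relation.Nullary.Decidable using (dec-true; dec-false; map′; _×-dec_; _⊎-dec_)
open import Relation.Binary.PropositionalEquality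

open import Algebra.Properties.CommutativeMonoid.Sum +-0-commutativeMonoid
  using (sum-cong-≗; sum-replicate-zero; sum-remove; ∑-distrib-+) renaming (sum to ∑)

𝟙 : Bool → ℕ
𝟙 b = if b then 1 else 0

𝟙-≢true : ∀ {b} → b ≢ true → 𝟙 b ≡ 0
𝟙-≢true b≢true = cong 𝟙 (¬-not b≢true)

𝟙-∨ : ∀ {a b} → (a ≡ true → b ≡ true → ⊥) → 𝟙 (a ∨ b) ≡ 𝟙 a + 𝟙 b
𝟙-∨ {true}  {true}  disjoint = ⊥-elim (disjoint refl refl)
𝟙-∨ {true}  {false} _ = refl
𝟙-∨ {false} _ = refl

sum-tabulate : ∀ {n} (t : Fin n → ℕ) → sum (tabulate t) ≡ ∑ t
sum-tabulate {zero}  t = refl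
sum-tabulate {suc n} t = cong (t zero +_) (sum-tabulate (t ∘ suc))

∑-zero : ∀ {n} {t : Fin n → ℕ} → (∀ u → t u ≡ 0) → ∑ t ≡ 0
∑-zero {n} t≗0 = trans (sum-cong-≗ t≗0) (sum-replicate-zero n)

∑-single : ∀ {n} {t : Fin n → ℕ} (a : Fin n) → (∀ u → u ≢ a → t u ≡ 0) → ∑ t ≡ t a
∑-single {suc n} {t} a t≗0 = begin
  ∑ t                         ≡⟨ sum-remove t ⟩
  t a + ∑ (t ∘ punchIn a)     ≡⟨ cong (t a +_) (∑-zero (λ u → t≗0 (punchIn a u) (punchInᵢ≢i a u))) ⟩
  t a + 0                     ≡⟨ +-identityʳ (t a) ⟩
  t a                         ∎
  where open ≡-Reasoning

∑-pair : ∀ {n} {t : Fin n → ℕ} {a c : Fin n} → a ≢ c →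
         (∀ u → u ≢ a → u ≢ c → t u ≡ 0) → ∑ t ≡ t a + t c
∑-pair {suc n} {t} {a} {c} a≢c t≗0 = begin
  ∑ t                          ≡⟨ sum-remove t ⟩
  t a + ∑ (t ∘ punchIn a)      ≡⟨ cong (t a +_) (∑-single (punchOut a≢c) rest≗0) ⟩
  t a + t (punchIn a (punchOut a≢c)) ≡⟨ cong (λ u → t a + t u) (punchIn-punchOut a≢c) ⟩
  t a + t c                    ∎
  where
  open ≡-Reasoning
  rest≗0 : ∀ u → u ≢ punchOut a≢c → t (punchIn a u) ≡ 0
  rest≗0 u u≢c = t≗0 (punchIn a u) (punchInᵢ≢i a u) (λ eq → u≢c (trans (sym (punchOut-punchIn a)) (punchOut-cong a eq)))

indeg≡∑ : ∀ {n} (D : Arcs n) x → indeg D x ≡ ∑ (λ u → 𝟙 (D u x))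
indeg≡∑ D x = trans (cong sum (map-tabulate id (λ u → 𝟙 (D u x)))) (sum-tabulate (λ u → 𝟙 (D u x)))

indeg-no-tail : ∀ {n} {D : Arcs n} {x} → (∀ u → D u x ≢ true) → indeg D x ≡ 0
indeg-no-tail {D = D} {x} no-arc = trans (indeg≡∑ D x) (∑-zero (λ u → 𝟙-≢true (no-arc u)))

indeg-one-tail : ∀ {n} {D : Arcs n} {x} a → (∀ u → D u x ≡ true → u ≡ a) → indeg D x ≡ 𝟙 (D a x)
indeg-one-tail {D = D} {x} a tail≡a =
  trans (indeg≡∑ D x) (∑-single a (λ u u≢a → 𝟙-≢true (u≢a ∘ tail≡a u)))

indeg-two-tails : ∀ {n} {D : Arcs n} {x a c} → a ≢ c → (∀ u → D u x ≡ true → u ≡ a ⊎ u ≡ c) →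
                  indeg D x ≡ 𝟙 (D a x) + 𝟙 (D c x)
indeg-two-tails {D = D} {x} {a} {c} a≢c tail∈ac = trans (indeg≡∑ D x) (∑-pair a≢c zero-elsewhere)
  where
  zero-elsewhere : ∀ u → u ≢ a → u ≢ c → 𝟙 (D u x) ≡ 0
  zero-elsewhere u u≢a u≢c = 𝟙-≢true λ arc → [ u≢a , u≢c ]′ (tail∈ac u arc)

_∪_ : ∀ {n} → Arcs n → Arcs n → Arcs n
(D ∪ E) u x = D u x ∨ E u x

indeg-∪ : ∀ {n} {D E : Arcs n} {x} → (∀ u → D u x ≡ true → E u x ≡ true → ⊥) →
          indeg (D ∪ E) x ≡ indeg D x + indeg E x
indeg-∪ {D = D} {E} {x} disjoint = begin
  indeg (D ∪ E) x                       ≡⟨ indeg≡∑ (D ∪ E) x ⟩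
  ∑ (λ u → 𝟙 (D u x ∨ E u x))           ≡⟨ sum-cong-≗ (λ u → 𝟙-∨ (disjoint u)) ⟩
  ∑ (λ u → 𝟙 (D u x) + 𝟙 (E u x))       ≡⟨ ∑-distrib-+ (λ u → 𝟙 (D u x)) (λ u → 𝟙 (E u x)) ⟩
  ∑ (λ u → 𝟙 (D u x)) + ∑ (λ u → 𝟙 (E u x)) ≡⟨ sym (cong₂ _+_ (indeg≡∑ D x) (indeg≡∑ E x)) ⟩
  indeg D x + indeg E x                 ∎
  where open ≡-Reasoning

module _ {n} {G F : Fin n → Fin n → Set} {D E : Arcs n}
         (F⊆G : ∀ {u x} → F u x → G u x) (F-sym : ∀ {u x} → F u x → F x u)
         (D-orients : IsOrientation (DeleteEdges G F) D) (E-orients : IsOrientation F E) where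

  private
    D-arcs : ∀ u x → D u x ≡ true → DeleteEdges G F u x
    D-arcs = proj₁ D-orients

    E-arcs : ∀ u x → E u x ≡ true → F u x
    E-arcs = proj₁ E-orients

  ∪-disjoint : ∀ u x → D u x ≡ true → E u x ≡ true → ⊥
  ∪-disjoint u x d e = proj₂ (D-arcs u x d) (E-arcs u x e)

  ∪-isOrientation : IsOrientation G (D ∪ E)
  ∪-isOrientation = arcs , total , antisym
    where
    arcs : ∀ u x → (D ∪ E) u x ≡ true → G u x
    arcs u x arc with D u x in d
    ... | true  = proj₁ (D-arcs u x d)
    ... | false = F⊆G (E-arcs u x arc)

    total : ∀ u x → G u x → (D ∪ E) u x ≡ true ⊎ (D ∪ E) x u ≡ true
    total u x edge with E u x in e₁ | E x u in e₂
    ... | true  | _    = inj₁ (∨-zeroʳ (D u x))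
    ... | false | true = inj₂ (∨-zeroʳ (D x u))
    ... | false | false = map (cong (_∨ false)) (cong (_∨ false)) (proj₁ (proj₂ D-orients) u x (edge , not-F))
      where
      not-F : ¬ F u x
      not-F f = [ (λ e → case trans (sym e₁) e of λ ()) , (λ e → case trans (sym e₂) e of λ ()) ]′
                  (proj₁ (proj₂ E-orients) u x f)

    antisym : ∀ u x → ¬ ((D ∪ E) u x ≡ true × (D ∪ E) x u ≡ true)
    antisym u x (ux , xu) with D u x in d₁ | D x u in d₂
    ... | true  | true  = proj₂ (proj₂ D-orients) u x (d₁ , d₂)
    ... | true  | false = proj₂ (D-arcs u x d₁) (F-sym (E-arcs x u xu))
    ... | false | true  = proj₂ (D-arcs x u d₂) (F-sym (E-arcs u x ux))
    ... | false | false = proj₂ (proj₂ E-orients) u x (ux , xu)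

  ∪-extends : Extends (DeleteEdges G F) D (D ∪ E)
  ∪-extends u x (_ , not-F) with E u x in e
  ... | false = ∨-identityʳ (D u x)
  ... | true  = ⊥-elim (not-F (E-arcs u x e))

dec-true⁻¹ : ∀ {a} {A : Set a} (a? : Dec A) → does a? ≡ true → A
dec-true⁻¹ (yes a) _ = a

OnPath : ∀ {n} → ℕ → (ℕ → Fin n) → Fin n → Set
OnPath ℓ w x = ∃ λ j → (1 ≤ j × j ≤ ℓ) × x ≡ w j

module _ {n} {ℓ : ℕ} {w : ℕ → Fin n} where

  PathEdge-sym : ∀ {u x} → PathEdge ℓ w u x → PathEdge ℓ w x u
  PathEdge-sym (i , bounds , inj₁ (u≡ , x≡)) = i , bounds , inj₂ (x≡ , u≡)
  PathEdge-sym (i , bounds , inj₂ (u≡ , x≡)) = i , bounds , inj₁ (x≡ , u≡)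

  PathEdge⇒OnPath : ∀ {u x} → PathEdge ℓ w u x → OnPath ℓ w x
  PathEdge⇒OnPath (i , (1≤i , i<ℓ) , inj₁ (_ , x≡)) = suc i , (s≤s z≤n , i<ℓ) , x≡
  PathEdge⇒OnPath (i , (1≤i , i<ℓ) , inj₂ (_ , x≡)) = i , (1≤i , <⇒≤ i<ℓ) , x≡

module Path {n} (ℓ : ℕ) (w : ℕ → Fin n)
            (w-injective : ∀ i j → i ≤ suc ℓ → j ≤ suc ℓ → w i ≡ w j → i ≡ j) where

  onPath? : ∀ x → Dec (OnPath ℓ w x)
  onPath? x = map′ (λ { (j , s≤s j≤ℓ , 1≤j , x≡) → j , (1≤j , j≤ℓ) , x≡ })
                   (λ { (j , (1≤j , j≤ℓ) , x≡) → j , s≤s j≤ℓ , 1≤j , x≡ })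
                   (anyUpTo? (λ j → (1 ≤? j) ×-dec (x ≟ w j)) (suc ℓ))

  ¬OnPath-w₀ : ¬ OnPath ℓ w (w 0)
  ¬OnPath-w₀ (j , (1≤j , j≤ℓ) , w₀≡w) =
    1+n≰n (subst (1 ≤_) (sym (w-injective 0 j z≤n (m≤n⇒m≤1+n j≤ℓ) w₀≡w)) 1≤j)

  ¬OnPath-w₁₊ℓ : ¬ OnPath ℓ w (w (suc ℓ))
  ¬OnPath-w₁₊ℓ (j , (1≤j , j≤ℓ) , w₁₊ℓ≡w) =
    1+n≰n (subst (_≤ ℓ) (sym (w-injective (suc ℓ) j ≤-refl (m≤n⇒m≤1+n j≤ℓ) w₁₊ℓ≡w)) j≤ℓ)

  w-injective-≤ℓ : ∀ {i j} → i ≤ ℓ → j ≤ ℓ → w i ≡ w j → i ≡ j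
  w-injective-≤ℓ {i} {j} i≤ℓ j≤ℓ = w-injective i j (m≤n⇒m≤1+n i≤ℓ) (m≤n⇒m≤1+n j≤ℓ)

  PathEdge-into : ∀ {u j} → j < ℓ → PathEdge ℓ w u (w (suc j)) → u ≡ w j ⊎ u ≡ w (suc (suc j))
  PathEdge-into {j = j} j<ℓ (i , (_ , i<ℓ) , inj₁ (u≡wi , w₁₊ⱼ≡w₁₊ᵢ))
    with refl ← w-injective-≤ℓ j<ℓ i<ℓ w₁₊ⱼ≡w₁₊ᵢ = inj₁ u≡wi
  PathEdge-into {j = j} j<ℓ (i , (_ , i<ℓ) , inj₂ (u≡w₁₊ᵢ , w₁₊ⱼ≡wᵢ))
    with refl ← w-injective-≤ℓ j<ℓ (<⇒≤ i<ℓ) w₁₊ⱼ≡wᵢ = inj₂ u≡w₁₊ᵢ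

  w-two-apart : ∀ {j} → suc j ≤ ℓ → w j ≢ w (suc (suc j))
  w-two-apart {j} j<ℓ eq = m≢1+n+m j (w-injective j (suc (suc j)) (m≤n⇒m≤1+n (<⇒≤ j<ℓ)) (s≤s j<ℓ) eq)

  module Oriented (forward : ℕ → Bool) where

    ArcOnEdge : ℕ → Fin n → Fin n → Set
    ArcOnEdge i u x = (forward i ≡ true × u ≡ w i × x ≡ w (suc i))
                    ⊎ (forward i ≡ false × u ≡ w (suc i) × x ≡ w i)

    PathArc : Fin n → Fin n → Set
    PathArc u x = ∃ λ i → i < ℓ × 1 ≤ i × ArcOnEdge i u x

    pathArc? : ∀ u x → Dec (PathArc u x)
    pathArc? u x = anyUpTo? (λ i → (1 ≤? i) ×-dec arcOnEdge? i) ℓ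
      where
      arcOnEdge? : ∀ i → Dec (ArcOnEdge i u x)
      arcOnEdge? i = (forward i ≟ᵇ true ×-dec u ≟ w i ×-dec x ≟ w (suc i))
                 ⊎-dec (forward i ≟ᵇ false ×-dec u ≟ w (suc i) ×-dec x ≟ w i)

    pathArcs : Arcs n
    pathArcs u x = does (pathArc? u x)

    pathArcs⇒PathEdge : ∀ {u x} → pathArcs u x ≡ true → PathEdge ℓ w u x
    pathArcs⇒PathEdge {u} {x} arc with dec-true⁻¹ (pathArc? u x) arc
    ... | i , i<ℓ , 1≤i , inj₁ (_ , u≡ , x≡) = i , (1≤i , i<ℓ) , inj₁ (u≡ , x≡)
    ... | i , i<ℓ , 1≤i , inj₂ (_ , u≡ , x≡) = i , (1≤i , i<ℓ) , inj₂ (u≡ , x≡)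

    PathEdge⇒pathArcs : ∀ {u x} → PathEdge ℓ w u x → pathArcs u x ≡ true ⊎ pathArcs x u ≡ true
    PathEdge⇒pathArcs {u} {x} (i , (1≤i , i<ℓ) , inj₁ (u≡ , x≡)) with forward i in f
    ... | true  = inj₁ (dec-true (pathArc? u x) (i , i<ℓ , 1≤i , inj₁ (f , u≡ , x≡)))
    ... | false = inj₂ (dec-true (pathArc? x u) (i , i<ℓ , 1≤i , inj₂ (f , x≡ , u≡)))
    PathEdge⇒pathArcs {u} {x} (i , (1≤i , i<ℓ) , inj₂ (u≡ , x≡)) with forward i in f
    ... | true  = inj₂ (dec-true (pathArc? x u) (i , i<ℓ , 1≤i , inj₁ (f , x≡ , u≡)))
    ... | false = inj₁ (dec-true (pathArc? u x) (i , i<ℓ , 1≤i , inj₂ (f , u≡ , x≡)))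

    pathArcs-antisym : ∀ u x → ¬ (pathArcs u x ≡ true × pathArcs x u ≡ true)
    pathArcs-antisym u x (ux , xu) = opposite (dec-true⁻¹ (pathArc? u x) ux) (dec-true⁻¹ (pathArc? x u) xu)
      where
      opposite : PathArc u x → PathArc x u → ⊥
      opposite (i , i<ℓ , _ , inj₁ (_ , refl , refl)) (j , j<ℓ , _ , inj₁ (_ , w₁₊ᵢ≡wⱼ , wᵢ≡w₁₊ⱼ))
        with refl ← w-injective-≤ℓ i<ℓ (<⇒≤ j<ℓ) w₁₊ᵢ≡wⱼ = w-two-apart i<ℓ wᵢ≡w₁₊ⱼ
      opposite (i , i<ℓ , _ , inj₁ (fᵢ , refl , refl)) (j , j<ℓ , _ , inj₂ (fⱼ , _ , wᵢ≡wⱼ))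
        with refl ← w-injective-≤ℓ (<⇒≤ i<ℓ) (<⇒≤ j<ℓ) wᵢ≡wⱼ = case trans (sym fᵢ) fⱼ of λ ()
      opposite (i , i<ℓ , _ , inj₂ (fᵢ , refl , refl)) (j , j<ℓ , _ , inj₁ (fⱼ , wᵢ≡wⱼ , _))
        with refl ← w-injective-≤ℓ (<⇒≤ i<ℓ) (<⇒≤ j<ℓ) wᵢ≡wⱼ = case trans (sym fᵢ) fⱼ of λ ()
      opposite (i , i<ℓ , _ , inj₂ (_ , refl , refl)) (j , j<ℓ , _ , inj₂ (_ , wᵢ≡w₁₊ⱼ , w₁₊ᵢ≡wⱼ))
        with refl ← w-injective-≤ℓ i<ℓ (<⇒≤ j<ℓ) w₁₊ᵢ≡wⱼ = w-two-apart i<ℓ wᵢ≡w₁₊ⱼ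

    pathArcs-isOrientation : IsOrientation (PathEdge ℓ w) pathArcs
    pathArcs-isOrientation = (λ _ _ → pathArcs⇒PathEdge) , (λ _ _ → PathEdge⇒pathArcs) , pathArcs-antisym

    pathArcs-along : ∀ {i} → 1 ≤ i → i < ℓ → pathArcs (w i) (w (suc i)) ≡ forward i
    pathArcs-along {i} 1≤i i<ℓ with forward i in f
    ... | true  = dec-true (pathArc? _ _) (i , i<ℓ , 1≤i , inj₁ (f , refl , refl))
    ... | false = ¬-not λ arc → pathArcs-antisym _ _ (arc , reverse)
      where
      reverse : pathArcs (w (suc i)) (w i) ≡ true
      reverse = dec-true (pathArc? _ _) (i , i<ℓ , 1≤i , inj₂ (f , refl , refl))

    pathArcs-against : ∀ {i} → 1 ≤ i → i < ℓ → pathArcs (w (suc i)) (w i) ≡ not (forward i)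
    pathArcs-against {i} 1≤i i<ℓ with forward i in f
    ... | false = dec-true (pathArc? _ _) (i , i<ℓ , 1≤i , inj₂ (f , refl , refl))
    ... | true  = ¬-not λ arc → pathArcs-antisym _ _ (arc , reverse)
      where
      reverse : pathArcs (w i) (w (suc i)) ≡ true
      reverse = dec-true (pathArc? _ _) (i , i<ℓ , 1≤i , inj₁ (f , refl , refl))

    pathArcs-from-offPath : ∀ {u x} → ¬ OnPath ℓ w u → pathArcs u x ≡ false
    pathArcs-from-offPath u∉P = ¬-not λ arc → u∉P (PathEdge⇒OnPath (PathEdge-sym (pathArcs⇒PathEdge arc)))

    indeg-pathArcs-offPath : ∀ {x} → ¬ OnPath ℓ w x → indeg pathArcs x ≡ 0
    indeg-pathArcs-offPath x∉P =
      indeg-no-tail {D = pathArcs} λ _ arc → x∉P (PathEdge⇒OnPath (pathArcs⇒PathEdge arc))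

    indeg-pathArcs-onPath : ∀ {j} → j < ℓ →
      indeg pathArcs (w (suc j)) ≡ 𝟙 (pathArcs (w j) (w (suc j))) + 𝟙 (pathArcs (w (suc (suc j))) (w (suc j)))
    indeg-pathArcs-onPath j<ℓ =
      indeg-two-tails {D = pathArcs} (w-two-apart j<ℓ) (λ _ arc → PathEdge-into j<ℓ (pathArcs⇒PathEdge arc))

odd : ℕ → Bool
odd zero    = false
odd (suc i) = not (odd i)

forward : ℕ → ℕ → Bool
forward m i = if does (i <? 4 + m) then odd i else does (i <? 5 + m)

forward-alternating : ∀ m {i} → i < 4 + m → forward m i ≡ odd i
forward-alternating m {i} i<4+m rewrite dec-true (i <? 4 + m) i<4+m = refl

forward-penultimate : ∀ m → forward m (4 + m) ≡ true
forward-penultimate m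
  rewrite dec-false (4 + m <? 4 + m) (<-irrefl refl) | dec-true (4 + m <? 5 + m) (n<1+n (4 + m)) = refl

forward-last : ∀ m → forward m (5 + m) ≡ false
forward-last m
  rewrite dec-false (5 + m <? 4 + m) (<-asym (n<1+n (4 + m))) | dec-false (5 + m <? 5 + m) (<-irrefl refl) = refl

forward-no-triple : ∀ m i → 2 + i < 6 + m →
                    ¬ (forward m i ≡ forward m (1 + i) × forward m (1 + i) ≡ forward m (2 + i))
forward-no-triple m i 2+i<6+m (fᵢ≡f₁₊ᵢ , f₁₊ᵢ≡f₂₊ᵢ) with 1 + i <? 4 + m
... | yes 1+i<4+m = not-¬ refl (begin
  odd i            ≡⟨ forward-alternating m (<-trans (n<1+n i) 1+i<4+m) ⟨
  forward m i      ≡⟨ fᵢ≡f₁₊ᵢ ⟩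
  forward m (1 + i) ≡⟨ forward-alternating m 1+i<4+m ⟩
  not (odd i)      ∎)
  where open ≡-Reasoning
... | no 1+i≮4+m with refl ← ≤-antisym (≤-pred (≤-pred 2+i<6+m)) (≮⇒≥ 1+i≮4+m) =
  case trans (sym (forward-penultimate m)) (trans f₁₊ᵢ≡f₂₊ᵢ (forward-last m)) of λ ()

interior-indeg≤3 : ∀ a b → 1 + (𝟙 a + 𝟙 (not b)) ≤ 3
interior-indeg≤3 a b = s≤s (+-mono-≤ (𝟙≤1 a) (𝟙≤1 (not b)))
  where
  𝟙≤1 : ∀ c → 𝟙 c ≤ 1
  𝟙≤1 false = z≤n
  𝟙≤1 true  = s≤s z≤n

equal-interior-indeg⇒aligned : ∀ a b c → 1 + (𝟙 a + 𝟙 (not b)) ≡ 1 + (𝟙 b + 𝟙 (not c)) → a ≡ b × b ≡ c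
equal-interior-indeg⇒aligned true  true  true  _ = refl , refl
equal-interior-indeg⇒aligned false false false _ = refl , refl
equal-interior-indeg⇒aligned true  true  false ()
equal-interior-indeg⇒aligned true  false true  ()
equal-interior-indeg⇒aligned true  false false ()
equal-interior-indeg⇒aligned false true  true  ()
equal-interior-indeg⇒aligned false true  false ()
equal-interior-indeg⇒aligned false false true  ()

module Extension (m k n : ℕ) (3≤k : 3 ≤ k) (G : Graph n) (v : Fin n) (w : ℕ → Fin n)
  (w-injective : ∀ i j → i ≤ suc (6 + m) → j ≤ suc (6 + m) → w i ≡ w j → i ≡ j)
  (v∉w : ∀ i → i ≤ suc (6 + m) → v ≢ w i)
  (path : ∀ i → 1 ≤ i → i < 6 + m → Adj G (w i) (w (suc i)))
  (neighbours : ∀ i → 1 ≤ i → i ≤ 6 + m → ∀ u →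
                Adj G (w i) u ⇔ (u ≡ w (i ∸ 1) ⊎ u ≡ v ⊎ u ≡ w (suc i)))
  (D : Arcs n) (D-proper : IsProperKOrientation k (DeleteEdges (Adj G) (PathEdge (6 + m) w)) D)
  (v→w : ∀ i → 1 ≤ i → i ≤ 6 + m → D v (w i) ≡ true)
  (indeg-first≤2 : indeg D (w 1) ≤ 2) (indeg-last≡2 : indeg D (w (6 + m)) ≡ 2) (4≤indeg-v : 4 ≤ indeg D v)
  where

  private
    ℓ : ℕ
    ℓ = 6 + m

    H : Fin n → Fin n → Set
    H = DeleteEdges (Adj G) (PathEdge ℓ w)

  open Path ℓ w w-injective
  open Oriented (forward m)

  D' : Arcs n
  D' = D ∪ pathArcs

  PathEdge⊆G : ∀ {u x} → PathEdge ℓ w u x → Adj G u x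
  PathEdge⊆G (i , (1≤i , i<ℓ) , inj₁ (refl , refl)) = path i 1≤i i<ℓ
  PathEdge⊆G (i , (1≤i , i<ℓ) , inj₂ (refl , refl)) = Graph.sym G (path i 1≤i i<ℓ)

  ¬OnPath-v : ¬ OnPath ℓ w v
  ¬OnPath-v (j , (_ , j≤ℓ) , v≡wⱼ) = v∉w j (m≤n⇒m≤1+n j≤ℓ) v≡wⱼ

  D'-isOrientation : IsOrientation (Adj G) D'
  D'-isOrientation = ∪-isOrientation PathEdge⊆G PathEdge-sym (proj₁ D-proper) pathArcs-isOrientation

  D'-extends : Extends H D D'
  D'-extends = ∪-extends PathEdge⊆G PathEdge-sym (proj₁ D-proper) pathArcs-isOrientation

  indeg-D' : ∀ x → indeg D' x ≡ indeg D x + indeg pathArcs x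
  indeg-D' x = indeg-∪ {D = D} {E = pathArcs}
    (λ u → ∪-disjoint PathEdge⊆G PathEdge-sym (proj₁ D-proper) pathArcs-isOrientation u x)

  indeg-offPath : ∀ {x} → ¬ OnPath ℓ w x → indeg D' x ≡ indeg D x
  indeg-offPath {x} x∉P =
    trans (indeg-D' x) (trans (cong (indeg D x +_) (indeg-pathArcs-offPath x∉P)) (+-identityʳ _))

  indeg-onPath : ∀ {j} → j < ℓ → indeg D' (w (suc j)) ≡
    indeg D (w (suc j)) + (𝟙 (pathArcs (w j) (w (suc j))) + 𝟙 (pathArcs (w (suc (suc j))) (w (suc j))))
  indeg-onPath {j} j<ℓ =
    trans (indeg-D' (w (suc j))) (cong (indeg D (w (suc j)) +_) (indeg-pathArcs-onPath j<ℓ))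

  indeg-D-interior : ∀ {j} → 1 ≤ j → suc j < ℓ → indeg D (w (suc j)) ≡ 1
  indeg-D-interior {j} 1≤j 1+j<ℓ =
    trans (indeg-one-tail {D = D} v tail≡v) (cong 𝟙 (v→w (suc j) (s≤s z≤n) (<⇒≤ 1+j<ℓ)))
    where
    tail≡v : ∀ u → D u (w (suc j)) ≡ true → u ≡ v
    tail≡v u arc with proj₁ (proj₁ D-proper) u (w (suc j)) arc
    ... | adj , ¬path with Equivalence.to (neighbours (suc j) (s≤s z≤n) (<⇒≤ 1+j<ℓ) u) (Graph.sym G adj)
    ... | inj₁ refl          = ⊥-elim (¬path (j , (1≤j , <-trans (n<1+n j) 1+j<ℓ) , inj₁ (refl , refl)))
    ... | inj₂ (inj₁ u≡v)    = u≡v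
    ... | inj₂ (inj₂ refl)   = ⊥-elim (¬path (suc j , (s≤s z≤n , 1+j<ℓ) , inj₂ (refl , refl)))

  indeg-first : indeg D' (w 1) ≡ indeg D (w 1)
  indeg-first = trans (indeg-onPath (s≤s z≤n)) (trans (cong (indeg D (w 1) +_) no-path-arc) (+-identityʳ _))
    where
    no-path-arc : 𝟙 (pathArcs (w 0) (w 1)) + 𝟙 (pathArcs (w 2) (w 1)) ≡ 0
    no-path-arc = cong₂ _+_ (cong 𝟙 (pathArcs-from-offPath ¬OnPath-w₀))
      (cong 𝟙 (trans (pathArcs-against (s≤s z≤n) (s≤s (s≤s z≤n))) (cong not (forward-alternating m (s≤s (s≤s z≤n))))))

  indeg-interior : ∀ {j} → 1 ≤ j → suc j < ℓ →
                   indeg D' (w (suc j)) ≡ 1 + (𝟙 (forward m j) + 𝟙 (not (forward m (suc j))))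
  indeg-interior {j} 1≤j 1+j<ℓ = trans (indeg-onPath j<ℓ)
    (cong₂ _+_ (indeg-D-interior 1≤j 1+j<ℓ)
               (cong₂ _+_ (cong 𝟙 (pathArcs-along 1≤j j<ℓ)) (cong 𝟙 (pathArcs-against (s≤s z≤n) 1+j<ℓ))))
    where
    j<ℓ : j < ℓ
    j<ℓ = <-trans (n<1+n j) 1+j<ℓ

  indeg-last : indeg D' (w ℓ) ≡ 2
  indeg-last = trans (indeg-onPath ≤-refl) (cong₂ _+_ indeg-last≡2 no-path-arc)
    where
    no-path-arc : 𝟙 (pathArcs (w (5 + m)) (w ℓ)) + 𝟙 (pathArcs (w (suc ℓ)) (w ℓ)) ≡ 0
    no-path-arc = cong₂ _+_ (cong 𝟙 (trans (pathArcs-along (s≤s z≤n) ≤-refl) (forward-last m)))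
                            (cong 𝟙 (pathArcs-from-offPath ¬OnPath-w₁₊ℓ))

  indeg-second : indeg D' (w 2) ≡ 3
  indeg-second = trans (indeg-interior (s≤s z≤n) (s≤s (s≤s (s≤s z≤n))))
    (cong₂ (λ a b → 1 + (𝟙 a + 𝟙 (not b)))
           (forward-alternating m (s≤s (s≤s z≤n))) (forward-alternating m (s≤s (s≤s (s≤s z≤n)))))

  indeg-penultimate : indeg D' (w (5 + m)) ≡ 3
  indeg-penultimate = trans (indeg-interior (s≤s z≤n) ≤-refl)
    (cong₂ (λ a b → 1 + (𝟙 a + 𝟙 (not b))) (forward-penultimate m) (forward-last m))

  path-indeg≤3 : ∀ j → j < ℓ → indeg D' (w (suc j)) ≤ 3
  path-indeg≤3 zero _ = ≤-trans (≤-reflexive indeg-first) (≤-trans indeg-first≤2 (n≤1+n 2))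
  path-indeg≤3 (suc i) 1+i<ℓ with suc (suc i) <? ℓ
  ... | yes 2+i<ℓ = ≤-trans (≤-reflexive (indeg-interior (s≤s z≤n) 2+i<ℓ))
                           (interior-indeg≤3 (forward m (suc i)) (forward m (suc (suc i))))
  ... | no 2+i≮ℓ with refl ← ≤-antisym 1+i<ℓ (≮⇒≥ 2+i≮ℓ) = ≤-trans (≤-reflexive indeg-last) (n≤1+n 2)

  path-proper : ∀ j → suc j < ℓ → indeg D' (w (suc j)) ≢ indeg D' (w (suc (suc j)))
  path-proper zero _ eq = <⇒≢ (s≤s indeg-first≤2) (trans (sym indeg-first) (trans eq indeg-second))
  path-proper (suc i) 2+i<ℓ eq with suc (suc (suc i)) <? ℓ
  ... | yes 3+i<ℓ = forward-no-triple m (suc i) 3+i<ℓ (equal-interior-indeg⇒aligned _ _ _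
          (trans (sym (indeg-interior (s≤s z≤n) 2+i<ℓ)) (trans eq (indeg-interior (s≤s z≤n) 3+i<ℓ))))
  ... | no 3+i≮ℓ with refl ← ≤-antisym 2+i<ℓ (≮⇒≥ 3+i≮ℓ) =
          case trans (sym indeg-penultimate) (trans eq indeg-last) of λ ()

  boundary-proper : ∀ {x y} → indeg D' x ≡ indeg D x → ¬ OnPath ℓ w y → Adj G x y →
                    indeg D' x ≢ indeg D' y
  boundary-proper x-unchanged y∉P adj eq = proj₁ (proj₂ D-proper) _ _ (adj , y∉P ∘ PathEdge⇒OnPath)
    (trans (sym x-unchanged) (trans eq (indeg-offPath y∉P)))

  left-neighbour-proper : ∀ j → j < ℓ → Adj G (w (suc j)) (w j) → indeg D' (w (suc j)) ≢ indeg D' (w j)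
  left-neighbour-proper zero    _    adj = boundary-proper indeg-first ¬OnPath-w₀ adj
  left-neighbour-proper (suc i) i<ℓ _   = ≢-sym (path-proper i i<ℓ)

  right-neighbour-proper : ∀ j → j < ℓ → Adj G (w (suc j)) (w (suc (suc j))) →
                           indeg D' (w (suc j)) ≢ indeg D' (w (suc (suc j)))
  right-neighbour-proper j j<ℓ adj with suc j <? ℓ
  ... | yes 1+j<ℓ = path-proper j 1+j<ℓ
  ... | no 1+j≮ℓ with refl ← ≤-antisym j<ℓ (≮⇒≥ 1+j≮ℓ) =
          boundary-proper (trans indeg-last (sym indeg-last≡2)) ¬OnPath-w₁₊ℓ adj

  hub-proper : ∀ j → j < ℓ → indeg D' (w (suc j)) ≢ indeg D' v
  hub-proper j j<ℓ = <⇒≢ (begin-strict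
    indeg D' (w (suc j)) ≤⟨ path-indeg≤3 j j<ℓ ⟩
    3                    <⟨ 4≤indeg-v ⟩
    indeg D v            ≡⟨ indeg-offPath ¬OnPath-v ⟨
    indeg D' v           ∎)
    where open ≤-Reasoning

  path-vertex-proper : ∀ {j y} → j < ℓ → Adj G (w (suc j)) y → indeg D' (w (suc j)) ≢ indeg D' y
  path-vertex-proper {j} {y} j<ℓ adj with Equivalence.to (neighbours (suc j) (s≤s z≤n) j<ℓ y) adj
  ... | inj₁ refl        = left-neighbour-proper j j<ℓ adj
  ... | inj₂ (inj₁ refl) = hub-proper j j<ℓ
  ... | inj₂ (inj₂ refl) = right-neighbour-proper j j<ℓ adj

  D'-proper : ∀ u x → Adj G u x → indeg D' u ≢ indeg D' x
  D'-proper u x adj with onPath? u | onPath? x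
  ... | yes (suc i , (s≤s z≤n , i<ℓ) , refl) | _ = path-vertex-proper i<ℓ adj
  ... | no _ | yes (suc i , (s≤s z≤n , i<ℓ) , refl) = ≢-sym (path-vertex-proper i<ℓ (Graph.sym G adj))
  ... | no u∉P | no x∉P = boundary-proper (indeg-offPath u∉P) x∉P adj

  D'-bounded : ∀ u → indeg D' u ≤ k
  D'-bounded u with onPath? u
  ... | yes (suc i , (s≤s z≤n , i<ℓ) , refl) = ≤-trans (path-indeg≤3 i i<ℓ) 3≤k
  ... | no u∉P = ≤-trans (≤-reflexive (indeg-offPath u∉P)) (proj₂ (proj₂ D-proper) u)

  extendsToProper : ExtendsToProper k G H D
  extendsToProper = D' , (D'-isOrientation , D'-proper , D'-bounded) , D'-extends

lemma27 : (ℓ k n : ℕ) → 6 ≤ ℓ → 3 ≤ k → (G : Graph n) →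
          (v : Fin n) → (w : ℕ → Fin n) →
          (∀ i j → i ≤ suc ℓ → j ≤ suc ℓ → w i ≡ w j → i ≡ j) →
          (∀ i → i ≤ suc ℓ → v ≢ w i) →
          (∀ i → 1 ≤ i → i < ℓ → Adj G (w i) (w (suc i))) →
          (∀ i → 1 ≤ i → i ≤ ℓ → ∀ u →
             Adj G (w i) u ⇔ (u ≡ w (i ∸ 1) ⊎ u ≡ v ⊎ u ≡ w (suc i))) →
          (D₁ D₂ : Arcs n) →
          IsProperKOrientation k (DeleteEdges (Adj G) (PathEdge ℓ w)) D₁ →
          IsProperKOrientation k (DeleteEdges (Adj G) (PathEdge ℓ w)) D₂ →
          (∀ i → 1 ≤ i → i ≤ ℓ → D₁ v (w i) ≡ true × D₂ v (w i) ≡ true) →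
          indeg D₁ (w ℓ) ≡ 2 → indeg D₂ (w ℓ) ≡ 2 →
          4 ≤ indeg D₁ v → 4 ≤ indeg D₂ v →
          indeg D₁ (w 1) ≡ 2 → indeg D₂ (w 1) ≡ 1 →
          ExtendsToProper k G (DeleteEdges (Adj G) (PathEdge ℓ w)) D₁ ×
          ExtendsToProper k G (DeleteEdges (Adj G) (PathEdge ℓ w)) D₂
lemma27 .(6 + m) k n (s≤s (s≤s (s≤s (s≤s (s≤s (s≤s {n = m} z≤n)))))) 3≤k G v w w-injective v∉w path neighbours
        D₁ D₂ D₁-proper D₂-proper v→w last₁ last₂ hub₁ hub₂ first₁ first₂ =
  extendsToProper D₁ D₁-proper (λ i 1≤i i≤ℓ → proj₁ (v→w i 1≤i i≤ℓ)) (≤-reflexive first₁) last₁ hub₁ ,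
  extendsToProper D₂ D₂-proper (λ i 1≤i i≤ℓ → proj₂ (v→w i 1≤i i≤ℓ)) (≤-trans (≤-reflexive first₂) (n≤1+n 1)) last₂ hub₂
  where open Extension m k n 3≤k G v w w-injective v∉w path neighbours using (extendsToProper)
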